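{- (d'Ocagne's identity) Let $k>0$ be a real number. For all integers $m\ge n\ge 0$, $$Q_{P_{k,m}}\,Q_{P_{k,n+1}}-Q_{P_{k,m+1}}\,Q_{P_{k,n}}=(-1)^n\,k^n\,P_{k,m-n}\,\Big[(1+k)+2\,i+(2k^2+6k+4)\,\varepsilon+(4k+8)\,i\,\varepsilon\Big].$$
   Context: Dual-complex numbers are expressions $x_1+i\,x_2+\varepsilon\,y_1+i\,\varepsilon\,y_2$ with $x_1,x_2,y_1,y_2$ real, forming the commutative ring $\mathbb{C}[\varepsilon]/(\varepsilon^2)$: $i^2=-1$, $\varepsilon\neq 0$, $\varepsilon^2=0$, $(i\varepsilon)^2=0$, $i\varepsilon=\varepsilon i$, with multiplication extended bilinearly. The $k$-Pell numbers are defined by $P_{k,0}=0$, $P_{k,1}=1$, $P_{k,n+1}=2P_{k,n}+kP_{k,n-1}$ for $n\ge1$. The dual-complex $k$-Pell quaternion is $Q_{P_{k,n}}=P_{k,n}+i\,P_{k,n+1}+\varepsilon\,P_{k,n+2}+i\,\varepsilon\,P_{k,n+3}$. -}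

module Defs where

open import Level using (_⊔_)
open import Data.Nat using (ℕ; zero; suc)
open import Data.Product using (_×_)
open import Algebra.Bundles using (CommutativeRing)

-- Dual-complex numbers and k-Pell quaternions over an arbitrary
-- commutative ring R (the paper works over the reals).
module DualComplex {c ℓ} (R : CommutativeRing c ℓ) where
  open CommutativeRing R

  -- x1 + i x2 + ε y1 + i ε y2
  record DC : Set c where
    constructor dc
    field
      re  : Carrier
      im  : Carrier
      du  : Carrier
      idu : Carrier
  open DC public

  _≈D_ : DC → DC → Set ℓ
  p ≈D q = (re p ≈ re q) × (im p ≈ im q) × (du p ≈ du q) × (idu p ≈ idu q)

  infixl 6 _+D_ _-D_
  infixl 7 _*D_ _·D_

  _+D_ : DC → DC → DC
  dc a b c' d +D dc a' b' c'' d' = dc (a + a') (b + b') (c' + c'') (d + d')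

  -D_ : DC → DC
  -D (dc a b c' d) = dc (- a) (- b) (- c') (- d)

  _-D_ : DC → DC → DC
  p -D q = p +D (-D q)

  -- product in C[ε]/(ε²): with z = a+ib, w = c+id,
  -- (z + εw)(z' + εw') = zz' + ε(zw' + wz'),  i² = -1, ε² = 0, iε = εi.
  _*D_ : DC → DC → DC
  dc a b c' d *D dc a' b' c'' d' =
    dc (a * a' - b * b')
       (a * b' + b * a')
       ((a * c'' - b * d') + (c' * a' - d * b'))
       ((a * d' + b * c'') + (c' * b' + d * a'))

  _·D_ : Carrier → DC → DC
  s ·D dc a b c' d = dc (s * a) (s * b) (s * c') (s * d)

  pow : Carrier → ℕ → Carrier
  pow x zero    = 1#
  pow x (suc n) = x * pow x n

  2# : Carrier
  2# = 1# + 1#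

  Pell : Carrier → ℕ → Carrier
  Pell k zero          = 0#
  Pell k (suc zero)    = 1#
  Pell k (suc (suc n)) = 2# * Pell k (suc n) + k * Pell k n

  QP : Carrier → ℕ → DC
  QP k n = dc (Pell k n) (Pell k (suc n)) (Pell k (suc (suc n))) (Pell k (suc (suc (suc n))))

  num : ℕ → Carrier
  num zero    = 0#
  num (suc n) = 1# + num n

-- A dual-complex k-Pell quaternion is determined by two consecutive
-- k-Pell numbers: Q(x, y) = x + i y + ε y' + iε y'' where y' and y'' are
-- the next two terms of the recurrence.  The proof has two halves.
--
--  * Quaternion half: for arbitrary x₁ y₁ x₂ y₂ the quaternion
--    difference Q(x₁,y₁) Q(y₂,y₂') - Q(y₁,y₁') Q(x₂,y₂) equals the
--    determinant (x₁ y₂ - y₁ x₂) times a fixed quaternion ω k.  This is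
--    a polynomial identity in five variables, checked by the ring solver.
--  * Scalar half: shifting both pairs one step multiplies the
--    determinant by -k, so by induction
--    P(m) P(n+1) - P(m+1) P(n) = (-1)^n k^n P(m-n)  (scalar d'Ocagne).
--
-- The ring solver of the standard library needs a coefficient ring
-- mapping into the ring at hand; for an arbitrary commutative ring we
-- supply the integers, represented as normalised formal differences of
-- natural numbers.  Polynomial expressions then form a commutative ring
-- under semantic equality, so the dual-complex operations can be
-- instantiated on expressions directly and handed to the solver.
module Submission where

open import Defs
open import Data.Nat using (ℕ; zero; suc; _≤_; _∸_)
open import Algebra.Bundles using (CommutativeRing; RawRing)
import Data.Nat as ℕ
open import Data.Nat.Properties using (m+[n∸m]≡n)
import Data.Nat.Properties as ℕₚ
open import Data.Product using (_×_; _,_)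
open import Data.Maybe using (just; nothing)
open import Data.Vec using (Vec)
open import Level using (0ℓ; _⊔_)
open import Relation.Nullary using (yes; no)
open import Relation.Binary.Definitions using (WeaklyDecidable)
open import Relation.Binary.PropositionalEquality using (_≡_; cong; subst)
import Relation.Binary.PropositionalEquality as ≡
open import Algebra.Solver.Ring.AlmostCommutativeRing
  using (fromCommutativeRing; _-Raw-AlmostCommutative⟶_; Induced-equivalence)
open import Algebra.Morphism.Structures using (IsRingMonomorphism)
import Algebra.Solver.Ring as RingSolver
import Algebra.Construct.Pointwise as Pointwise
import Algebra.Morphism.RingMonomorphism as RingMonomorphism

module IntegerCoefficients {c ℓ} (R : CommutativeRing c ℓ) where
  open CommutativeRing R
  open import Algebra.Properties.Ring ring using (-0#≈0#)
  open import Algebra.Properties.AbelianGroup +-abelianGroup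
    using (⁻¹-∙-comm; ⁻¹-anti-homo‿-)
  open import Algebra.Properties.CommutativeSemigroup +-commutativeSemigroup
    using (interchange)
  open import Algebra.Properties.Semiring.Mult.TCOptimised semiring
    using (×-homo-+; ×1-homo-*) renaming (_×_ to _·ℕ_)
  open import Relation.Binary.Reasoning.Setoid setoid

  ι : ℕ → Carrier
  ι n = n ·ℕ 1#

  -‿interchange : ∀ a b c d → (a + b) - (c + d) ≈ (a - c) + (b - d)
  -‿interchange a b c d = begin
    (a + b) + - (c + d)    ≈⟨ +-congˡ (⁻¹-∙-comm c d) ⟨
    (a + b) + (- c + - d)  ≈⟨ interchange a b (- c) (- d) ⟩
    (a + - c) + (b + - d)  ∎

  difference-cong : ∀ {a b c d} → a + d ≈ b + c → a - b ≈ c - d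
  difference-cong {a} {b} {c} {d} a+d≈b+c = begin
    a - b                  ≈⟨ +-identityʳ (a - b) ⟨
    (a - b) + 0#           ≈⟨ +-congˡ (-‿inverseʳ d) ⟨
    (a - b) + (d - d)      ≈⟨ interchange a (- b) d (- d) ⟩
    (a + d) + (- b + - d)  ≈⟨ +-cong a+d≈b+c (⁻¹-∙-comm b d) ⟩
    (b + c) - (b + d)      ≈⟨ -‿interchange b c b d ⟩
    (b - b) + (c - d)      ≈⟨ +-congʳ (-‿inverseʳ b) ⟩
    0# + (c - d)           ≈⟨ +-identityˡ (c - d) ⟩
    c - d                  ∎

  difference-* : ∀ a b c d → (a - b) * (c - d) ≈ (a * c + b * d) - (a * d + b * c)
  difference-* a b c d = begin
    (a - b) * (c - d)                      ≈⟨ [y-z]x≈yx-zx (c - d) a b ⟩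
    a * (c - d) - b * (c - d)              ≈⟨ +-cong (x[y-z]≈xy-xz a c d) (-‿cong (x[y-z]≈xy-xz b c d)) ⟩
    (a * c - a * d) - (b * c - b * d)      ≈⟨ +-congˡ (⁻¹-anti-homo‿- (b * c) (b * d)) ⟩
    (a * c - a * d) + (b * d - b * c)      ≈⟨ -‿interchange (a * c) (b * d) (a * d) (b * c) ⟨
    (a * c + b * d) - (a * d + b * c)      ∎
    where open import Algebra.Properties.Ring ring using ([y-z]x≈yx-zx; x[y-z]≈xy-xz)

  -- An integer as a formal difference (a , b) of natural numbers, a - b.
  Diff : Set
  Diff = ℕ × ℕ

  -- Cancel the common part, so that equal integers get equal codes.
  normalise : Diff → Diff
  normalise (suc a , suc b) = normalise (a , b)
  normalise p               = p

  Integers : RawRing 0ℓ 0ℓ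
  Integers = record
    { Carrier = Diff
    ; _≈_     = _≡_
    ; _+_     = λ { (a , b) (c , d) → normalise (a ℕ.+ c , b ℕ.+ d) }
    ; _*_     = λ { (a , b) (c , d) →
                    normalise (a ℕ.* c ℕ.+ b ℕ.* d , a ℕ.* d ℕ.+ b ℕ.* c) }
    ; -_      = λ { (a , b) → (b , a) }
    ; 0#      = (0 , 0)
    ; 1#      = (1 , 0)
    }

  -- Interpretation in R; non-negative codes avoid the subtraction, so
  -- that the codes of 0 and 1 denote 0# and 1# definitionally.
  ⟦_⟧ᵢ : Diff → Carrier
  ⟦ a , zero  ⟧ᵢ = ι a
  ⟦ a , suc b ⟧ᵢ = ι a - ι (suc b)

  ⟦⟧ᵢ-difference : ∀ a b → ⟦ a , b ⟧ᵢ ≈ ι a - ι b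
  ⟦⟧ᵢ-difference a zero    = sym (trans (+-congˡ -0#≈0#) (+-identityʳ (ι a)))
  ⟦⟧ᵢ-difference a (suc b) = refl

  ⟦⟧ᵢ-cong : ∀ a b c d → a ℕ.+ d ≡ b ℕ.+ c → ⟦ a , b ⟧ᵢ ≈ ⟦ c , d ⟧ᵢ
  ⟦⟧ᵢ-cong a b c d eq = begin
    ⟦ a , b ⟧ᵢ  ≈⟨ ⟦⟧ᵢ-difference a b ⟩
    ι a - ι b  ≈⟨ difference-cong ι-eq ⟩
    ι c - ι d  ≈⟨ ⟦⟧ᵢ-difference c d ⟨
    ⟦ c , d ⟧ᵢ  ∎
    where
    ι-eq : ι a + ι d ≈ ι b + ι c
    ι-eq = trans (sym (×-homo-+ 1# a d)) (trans (reflexive (cong ι eq)) (×-homo-+ 1# b c))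

  normalise-sound : ∀ p → ⟦ normalise p ⟧ᵢ ≈ ⟦ p ⟧ᵢ
  normalise-sound (zero  , b)     = refl
  normalise-sound (suc a , zero)  = refl
  normalise-sound (suc a , suc b) =
    trans (normalise-sound (a , b)) (⟦⟧ᵢ-cong a b (suc a) (suc b) cross-sum)
    where
    cross-sum : a ℕ.+ suc b ≡ b ℕ.+ suc a
    cross-sum = ≡.trans (ℕₚ.+-comm a (suc b)) (≡.sym (ℕₚ.+-suc b a))

  +-homoᵢ : ∀ a b c d → ⟦ normalise (a ℕ.+ c , b ℕ.+ d) ⟧ᵢ ≈ ⟦ a , b ⟧ᵢ + ⟦ c , d ⟧ᵢ
  +-homoᵢ a b c d = begin
    ⟦ normalise (a ℕ.+ c , b ℕ.+ d) ⟧ᵢ  ≈⟨ normalise-sound (a ℕ.+ c , b ℕ.+ d) ⟩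
    ⟦ a ℕ.+ c , b ℕ.+ d ⟧ᵢ              ≈⟨ ⟦⟧ᵢ-difference (a ℕ.+ c) (b ℕ.+ d) ⟩
    ι (a ℕ.+ c) - ι (b ℕ.+ d)          ≈⟨ +-cong (×-homo-+ 1# a c) (-‿cong (×-homo-+ 1# b d)) ⟩
    (ι a + ι c) - (ι b + ι d)          ≈⟨ -‿interchange (ι a) (ι c) (ι b) (ι d) ⟩
    (ι a - ι b) + (ι c - ι d)          ≈⟨ +-cong (⟦⟧ᵢ-difference a b) (⟦⟧ᵢ-difference c d) ⟨
    ⟦ a , b ⟧ᵢ + ⟦ c , d ⟧ᵢ              ∎

  *-homoᵢ : ∀ a b c d →
    ⟦ normalise (a ℕ.* c ℕ.+ b ℕ.* d , a ℕ.* d ℕ.+ b ℕ.* c) ⟧ᵢ ≈ ⟦ a , b ⟧ᵢ * ⟦ c , d ⟧ᵢ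
  *-homoᵢ a b c d = begin
    ⟦ normalise (a ℕ.* c ℕ.+ b ℕ.* d , a ℕ.* d ℕ.+ b ℕ.* c) ⟧ᵢ
      ≈⟨ normalise-sound (a ℕ.* c ℕ.+ b ℕ.* d , a ℕ.* d ℕ.+ b ℕ.* c) ⟩
    ⟦ a ℕ.* c ℕ.+ b ℕ.* d , a ℕ.* d ℕ.+ b ℕ.* c ⟧ᵢ
      ≈⟨ ⟦⟧ᵢ-difference (a ℕ.* c ℕ.+ b ℕ.* d) (a ℕ.* d ℕ.+ b ℕ.* c) ⟩
    ι (a ℕ.* c ℕ.+ b ℕ.* d) - ι (a ℕ.* d ℕ.+ b ℕ.* c)
      ≈⟨ +-cong (ι-sum-of-products a c b d) (-‿cong (ι-sum-of-products a d b c)) ⟩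
    (ι a * ι c + ι b * ι d) - (ι a * ι d + ι b * ι c)
      ≈⟨ difference-* (ι a) (ι b) (ι c) (ι d) ⟨
    (ι a - ι b) * (ι c - ι d)
      ≈⟨ *-cong (⟦⟧ᵢ-difference a b) (⟦⟧ᵢ-difference c d) ⟨
    ⟦ a , b ⟧ᵢ * ⟦ c , d ⟧ᵢ
      ∎
    where
    ι-sum-of-products : ∀ w x y z → ι (w ℕ.* x ℕ.+ y ℕ.* z) ≈ ι w * ι x + ι y * ι z
    ι-sum-of-products w x y z =
      trans (×-homo-+ 1# (w ℕ.* x) (y ℕ.* z)) (+-cong (×1-homo-* w x) (×1-homo-* y z))

  -‿homoᵢ : ∀ a b → ⟦ b , a ⟧ᵢ ≈ - ⟦ a , b ⟧ᵢ
  -‿homoᵢ a b = begin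
    ⟦ b , a ⟧ᵢ     ≈⟨ ⟦⟧ᵢ-difference b a ⟩
    ι b - ι a     ≈⟨ ⁻¹-anti-homo‿- (ι a) (ι b) ⟨
    - (ι a - ι b)  ≈⟨ -‿cong (⟦⟧ᵢ-difference a b) ⟨
    - ⟦ a , b ⟧ᵢ    ∎

  integerMorphism : Integers -Raw-AlmostCommutative⟶ fromCommutativeRing R
  integerMorphism = record
    { ⟦_⟧    = ⟦_⟧ᵢ
    ; +-homo = λ { (a , b) (c , d) → +-homoᵢ a b c d }
    ; *-homo = λ { (a , b) (c , d) → *-homoᵢ a b c d }
    ; -‿homo = λ { (a , b) → -‿homoᵢ a b }
    ; 0-homo = refl
    ; 1-homo = refl
    }

  -- Equality of integers is decidable, which lets the solver cancel terms.
  _≟ᵢ_ : WeaklyDecidable (Induced-equivalence integerMorphism)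
  (a , b) ≟ᵢ (c , d) with a ℕ.+ d ℕ.≟ b ℕ.+ c
  ... | yes eq = just (⟦⟧ᵢ-cong a b c d eq)
  ... | no _   = nothing

  open RingSolver Integers (fromCommutativeRing R) integerMorphism _≟ᵢ_
    using (Polynomial; ⟦_⟧; _:+_; _:*_; :-_; con)
  open RingSolver Integers (fromCommutativeRing R) integerMorphism _≟ᵢ_ public
    using (solve; _:=_)

  -- Polynomial expressions in n variables, identified when they denote
  -- the same function, form a commutative ring: they embed into the
  -- pointwise ring of functions Vec Carrier n → Carrier.
  module _ (n : ℕ) where
    private
      functionRing : CommutativeRing c (c ⊔ ℓ)
      functionRing = Pointwise.commutativeRing (Vec Carrier n) R

      expressions : RawRing 0ℓ (c ⊔ ℓ)
      expressions = record
        { Carrier = Polynomial n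
        ; _≈_     = λ p q → ∀ ρ → ⟦ p ⟧ ρ ≈ ⟦ q ⟧ ρ
        ; _+_     = _:+_
        ; _*_     = _:*_
        ; -_      = :-_
        ; 0#      = con (0 , 0)
        ; 1#      = con (1 , 0)
        }

      semantics : IsRingMonomorphism expressions (CommutativeRing.rawRing functionRing) ⟦_⟧
      semantics = record
        { isRingHomomorphism = record
          { isSemiringHomomorphism = record
            { isNearSemiringHomomorphism = record
              { +-isMonoidHomomorphism = record
                { isMagmaHomomorphism = record
                  { isRelHomomorphism = record { cong = λ p≈q → p≈q }
                  ; homo = λ _ _ _ → refl
                  }
                ; ε-homo = λ _ → refl
                }
              ; *-homo = λ _ _ _ → refl
              }
            ; 1#-homo = λ _ → refl
            }
          ; -‿homo = λ _ _ → refl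
          }
        ; injective = λ p≈q → p≈q
        }

    polynomialRing : CommutativeRing 0ℓ (c ⊔ ℓ)
    polynomialRing = record
      { isCommutativeRing = RingMonomorphism.isCommutativeRing semantics
          (CommutativeRing.isCommutativeRing functionRing)
      }

module DualComplexProperties {c ℓ} (R : CommutativeRing c ℓ) where
  open CommutativeRing R
  open DualComplex R

  ≈D-trans : ∀ {p q r : DC} → p ≈D q → q ≈D r → p ≈D r
  ≈D-trans (e₁ , e₂ , e₃ , e₄) (f₁ , f₂ , f₃ , f₄) =
    trans e₁ f₁ , trans e₂ f₂ , trans e₃ f₃ , trans e₄ f₄

  ·D-congʳ : ∀ {s t : Carrier} (w : DC) → s ≈ t → (s ·D w) ≈D (t ·D w)
  ·D-congʳ (dc _ _ _ _) s≈t = *-congʳ s≈t , *-congʳ s≈t , *-congʳ s≈t , *-congʳ s≈t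

-- The quaternions of the k-Pell recurrence, built from two consecutive
-- terms; stated over any commutative ring so that they can be used both
-- for values and for polynomial expressions.
module PellQuaternion {c ℓ} (S : CommutativeRing c ℓ) where
  open CommutativeRing S
  open DualComplex S

  next : Carrier → Carrier → Carrier → Carrier
  next k x y = 2# * y + k * x

  quaternion : Carrier → Carrier → Carrier → DC
  quaternion k x y = dc x y (next k x y) (next k y (next k x y))

  ω : Carrier → DC
  ω k = dc (1# + k) (num 2) (num 2 * (k * k) + num 6 * k + num 4) (num 4 * k + num 8)

  crossDifference : Carrier → Carrier → Carrier → Carrier → Carrier → DC
  crossDifference k a b x y =
    quaternion k a b *D quaternion k y (next k x y) -D quaternion k b (next k a b) *D quaternion k x y

  determinantMultiple : Carrier → Carrier → Carrier → Carrier → Carrier → DC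
  determinantMultiple k a b x y = (a * y - b * x) ·D ω k

-- Each polynomial identity is written with the
-- same definitions read in the ring of polynomial expressions, so that
-- its meaning in R is definitionally the statement being proved.
module PellIdentities {c ℓ} (R : CommutativeRing c ℓ) where
  open CommutativeRing R
  open DualComplex R
  open PellQuaternion R
  open IntegerCoefficients R
  open import Relation.Binary.Reasoning.Setoid setoid
  private
    module E = PellQuaternion (polynomialRing 5)
    module EDC = DualComplex (polynomialRing 5)
    module P₅ = CommutativeRing (polynomialRing 5)

  quaternionCross : ∀ k a b x y → crossDifference k a b x y ≈D determinantMultiple k a b x y
  quaternionCross k a b x y =
      solve 5 (λ k a b x y → EDC.re  (lhs k a b x y) := EDC.re  (rhs k a b x y)) refl k a b x y
    , solve 5 (λ k a b x y → EDC.im  (lhs k a b x y) := EDC.im  (rhs k a b x y)) refl k a b x y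
    , solve 5 (λ k a b x y → EDC.du  (lhs k a b x y) := EDC.du  (rhs k a b x y)) refl k a b x y
    , solve 5 (λ k a b x y → EDC.idu (lhs k a b x y) := EDC.idu (rhs k a b x y)) refl k a b x y
    where
    lhs rhs : P₅.Carrier → P₅.Carrier → P₅.Carrier → P₅.Carrier → P₅.Carrier → EDC.DC
    lhs = E.crossDifference
    rhs = E.determinantMultiple

  determinant-shift : ∀ k a b x y → b * next k x y - next k a b * y ≈ - 1# * k * (a * y - b * x)
  determinant-shift = solve 5
    (λ k a b x y → b P₅.* E.next k x y P₅.- E.next k a b P₅.* y
                := P₅.- P₅.1# P₅.* k P₅.* (a P₅.* y P₅.- b P₅.* x))
    refl

  pellDeterminant : ∀ k n d →
    Pell k (n ℕ.+ d) * Pell k (suc n) - Pell k (suc (n ℕ.+ d)) * Pell k n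
      ≈ pow (- 1#) n * pow k n * Pell k d
  pellDeterminant k zero d = begin
    Pell k d * 1# - Pell k (suc d) * 0#  ≈⟨ +-cong (*-identityʳ (Pell k d)) (-‿cong (zeroʳ (Pell k (suc d)))) ⟩
    Pell k d - 0#                       ≈⟨ +-congˡ -0#≈0# ⟩
    Pell k d + 0#                       ≈⟨ +-identityʳ (Pell k d) ⟩
    Pell k d                            ≈⟨ *-identityˡ (Pell k d) ⟨
    1# * Pell k d                       ≈⟨ *-congʳ (*-identityˡ 1#) ⟨
    1# * 1# * Pell k d                  ∎
    where open import Algebra.Properties.Ring ring using (-0#≈0#)
  pellDeterminant k (suc n) d = begin
    Pell k (suc (n ℕ.+ d)) * Pell k (suc (suc n)) - Pell k (suc (suc (n ℕ.+ d))) * Pell k (suc n)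
      ≈⟨ determinant-shift k (Pell k (n ℕ.+ d)) (Pell k (suc (n ℕ.+ d))) (Pell k n) (Pell k (suc n)) ⟩
    - 1# * k * (Pell k (n ℕ.+ d) * Pell k (suc n) - Pell k (suc (n ℕ.+ d)) * Pell k n)
      ≈⟨ *-congˡ (pellDeterminant k n d) ⟩
    - 1# * k * (pow (- 1#) n * pow k n * Pell k d)
      ≈⟨ regroup k (pow (- 1#) n) (pow k n) (Pell k d) ⟩
    pow (- 1#) (suc n) * pow k (suc n) * Pell k d
      ∎
    where
    regroup : ∀ k s t p → - 1# * k * (s * t * p) ≈ - 1# * s * (k * t) * p
    regroup = solve 4
      (λ k s t p → P₄.- P₄.1# P₄.* k P₄.* (s P₄.* t P₄.* p) := P₄.- P₄.1# P₄.* s P₄.* (k P₄.* t) P₄.* p)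
      refl
      where module P₄ = CommutativeRing (polynomialRing 4)

  pellDOcagne : ∀ k {m n} → n ≤ m →
    Pell k m * Pell k (suc n) - Pell k (suc m) * Pell k n ≈ pow (- 1#) n * pow k n * Pell k (m ∸ n)
  pellDOcagne k {m} {n} n≤m = subst
    (λ j → Pell k j * Pell k (suc n) - Pell k (suc j) * Pell k n ≈ pow (- 1#) n * pow k n * Pell k (m ∸ n))
    (m+[n∸m]≡n n≤m) (pellDeterminant k n (m ∸ n))

-- QP k n unfolds definitionally to quaternion k (Pell k n) (Pell k (n+1)),
-- so the theorem is the cross identity followed by scalar d'Ocagne.
mainTheorem4 : ∀ {c ℓ} (R : CommutativeRing c ℓ) →
    let open CommutativeRing R
        open DualComplex R
    in ∀ (k : Carrier) (m n : ℕ) → n ≤ m →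
       (QP k m *D QP k (suc n) -D QP k (suc m) *D QP k n)
         ≈D ((pow (- 1#) n * pow k n * Pell k (m ∸ n))
              ·D dc (1# + k) (num 2) (num 2 * (k * k) + num 6 * k + num 4) (num 4 * k + num 8))
mainTheorem4 R k m n n≤m =
  ≈D-trans (quaternionCross k (Pell k m) (Pell k (suc m)) (Pell k n) (Pell k (suc n)))
           (·D-congʳ (ω k) (pellDOcagne k n≤m))
  where
  open DualComplex R
  open DualComplexProperties R
  open PellQuaternion R using (ω)
  open PellIdentities R
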